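{- Let $n\ge 1$ and let $L$ be the $n\times n$ lower triangular matrix with entries $L_{m,k}=\binom{2m}{m+k}$ for $0\le m,k<n$ (so $L$ has ones on the diagonal and is invertible over the integers). Then the first column of $L^{ -1}$ satisfies $(L^{ -1})_{0,0}=1$ and $(L^{ -1})_{i,0}$ is an even integer for every $0<i<n$.
   Context: Matrices are indexed starting at $0$. Binomial coefficients $\binom{a}{b}$ are $0$ when $b>a$. -}

module Defs where

open import Data.Nat using (ℕ; _+_; _*_)
open import Data.Nat.Combinatorics using (_C_)
open import Data.Fin using (Fin; toℕ)
open import Data.Fin.Properties using (_≟_)
open import Data.Integer using (ℤ; +_)
import Data.Integer as ℤ
open import Data.Vec.Functional using (foldr)
open import Relation.Nullary using (yes; no)

Matrix : ℕ → Set
Matrix n = Fin n → Fin n → ℤ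

Σℤ : ∀ {n} → (Fin n → ℤ) → ℤ
Σℤ f = foldr ℤ._+_ (+ 0) f

_⊗_ : ∀ {n} → Matrix n → Matrix n → Matrix n
(A ⊗ B) i j = Σℤ (λ k → A i k ℤ.* B k j)

I : ∀ {n} → Matrix n
I i j with i ≟ j
... | yes _ = + 1
... | no  _ = + 0

-- L_{m,k} = binom(2m, m+k)  (binomial is 0 when m+k > 2m, i.e. k > m)
L : ∀ n → Matrix n
L n m k = + ((2 * toℕ m) C (toℕ m + toℕ k))

-- The first column y of L⁻¹ is y₀ = 1, y_k = 2(-1)^k for k ≥ 1, so it is enough to check L y = e₀.
-- Row m ≥ 1 of L y is C(2m,m) - 2 Σ_{k<m} (-1)^k C(2m, m+1+k); by Pascal's rule the alternating sum
-- telescopes to C(2m-1, m), and C(2m, m) = 2 C(2m-1, m) by symmetry. Since L is lower unitriangular it is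
-- invertible, and a left inverse M satisfies M e₀ = M L y = y.
module Submission where

open import Defs
open import Data.Nat using (ℕ; zero; suc; _≤_; _<_; _∸_; s≤s; z≤n)
import Data.Nat as ℕ
import Data.Nat.Properties as ℕ
open import Data.Nat.Combinatorics using (_C_; k>n⇒nCk≡0; nCn≡1; nCk≡nC[n∸k]; nCk+nC[k+1]≡[n+1]C[k+1])
open import Data.Fin using (Fin; zero; suc; toℕ)
open import Data.Fin.Properties using (_≟_; toℕ<n)
open import Data.Integer using (ℤ; +_; _+_; _*_; -_; _-_)
open import Data.Integer.Properties
  using (+-*-semiring; +-identityˡ; +-identityʳ; *-identityˡ; +-inverseˡ; +-inverseʳ; *-identityʳ; *-zeroʳ; *-assoc;
         neg-distrib-+; neg-distribˡ-*; neg-distribʳ-*; pos-+)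
open import Data.Integer.Divisibility using (_∣_; *-monoʳ-∣)
open import Data.Integer.Tactic.RingSolver using (solve-∀)
open import Data.Nat.Divisibility using (1∣_)
open import Data.Vec.Functional using (Vector)
open import Data.Product using (Σ; _×_; _,_)
open import Relation.Binary.PropositionalEquality
open import Relation.Nullary using (yes; no)
open import Algebra.Properties.Semiring.Sum +-*-semiring
  using (sum-cong-≗; sum-replicate-zero; ∑-comm; *-distribˡ-sum; *-distribʳ-sum)

∑-neg : ∀ {n} (f : Vector ℤ n) → Σℤ (λ k → - f k) ≡ - Σℤ f
∑-neg {zero}  f = refl
∑-neg {suc n} f = trans (cong (_+_ (- f zero)) (∑-neg (λ k → f (suc k)))) (sym (neg-distrib-+ (f zero) _))

∑-zero : ∀ {n} {f : Vector ℤ n} → (∀ k → f k ≡ + 0) → Σℤ f ≡ + 0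
∑-zero {n} f≡0 = trans (sum-cong-≗ f≡0) (sum-replicate-zero n)

_·_ : ∀ {n} → Matrix n → Vector ℤ n → Vector ℤ n
(A · v) i = Σℤ (λ k → A i k * v k)

I-suc : ∀ {n} (i j : Fin n) → I (suc i) (suc j) ≡ I i j
I-suc i j with i ≟ j
... | yes _ = refl
... | no  _ = refl

∑-δˡ : ∀ {n} (i : Fin n) (v : Vector ℤ n) → Σℤ (λ k → I i k * v k) ≡ v i
∑-δˡ {suc n} zero v =
  trans (cong₂ _+_ (*-identityˡ (v zero)) (sum-replicate-zero n)) (+-identityʳ (v zero))
∑-δˡ {suc n} (suc i) v = begin
  + 0 + Σℤ (λ k → I (suc i) (suc k) * v (suc k)) ≡⟨ +-identityˡ _ ⟩
  Σℤ (λ k → I (suc i) (suc k) * v (suc k))       ≡⟨ sum-cong-≗ (λ k → cong (_* v (suc k)) (I-suc i k)) ⟩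
  Σℤ (λ k → I i k * v (suc k))                   ≡⟨ ∑-δˡ i (λ k → v (suc k)) ⟩
  v (suc i)                                       ∎
  where open ≡-Reasoning

∑-δʳ : ∀ {n} (j : Fin n) (v : Vector ℤ n) → Σℤ (λ k → v k * I k j) ≡ v j
∑-δʳ {suc n} zero v =
  trans (cong₂ _+_ (*-identityʳ (v zero)) (∑-zero (λ k → *-zeroʳ (v (suc k))))) (+-identityʳ (v zero))
∑-δʳ {suc n} (suc j) v = begin
  v zero * + 0 + Σℤ (λ k → v (suc k) * I (suc k) (suc j)) ≡⟨ cong₂ _+_ (*-zeroʳ (v zero)) refl ⟩
  + 0 + Σℤ (λ k → v (suc k) * I (suc k) (suc j))          ≡⟨ +-identityˡ _ ⟩
  Σℤ (λ k → v (suc k) * I (suc k) (suc j))                ≡⟨ sum-cong-≗ (λ k → cong (v (suc k) *_) (I-suc k j)) ⟩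
  Σℤ (λ k → v (suc k) * I k j)                            ≡⟨ ∑-δʳ j (λ k → v (suc k)) ⟩
  v (suc j)                                               ∎
  where open ≡-Reasoning

·-neg : ∀ {n} (A : Matrix n) (v : Vector ℤ n) i → (A · (λ k → - v k)) i ≡ - (A · v) i
·-neg A v i = trans (sum-cong-≗ (λ k → sym (neg-distribʳ-* (A i k) (v k)))) (∑-neg (λ k → A i k * v k))

⊗-· : ∀ {n} (A B : Matrix n) (v : Vector ℤ n) i → ((A ⊗ B) · v) i ≡ (A · (B · v)) i
⊗-· A B v i = begin
  Σℤ (λ l → Σℤ (λ k → A i k * B k l) * v l)   ≡⟨ sum-cong-≗ (λ l → *-distribʳ-sum (v l) (λ k → A i k * B k l)) ⟩
  Σℤ (λ l → Σℤ (λ k → A i k * B k l * v l))   ≡⟨ ∑-comm (λ l k → A i k * B k l * v l) ⟩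
  Σℤ (λ k → Σℤ (λ l → A i k * B k l * v l))   ≡⟨ sum-cong-≗ (λ k → sum-cong-≗ (λ l → *-assoc (A i k) (B k l) (v l))) ⟩
  Σℤ (λ k → Σℤ (λ l → A i k * (B k l * v l))) ≡⟨ sum-cong-≗ (λ k → sym (*-distribˡ-sum (A i k) (λ l → B k l * v l))) ⟩
  Σℤ (λ k → A i k * Σℤ (λ l → B k l * v l))   ∎
  where open ≡-Reasoning

·-inverseˡ : ∀ {n} {M A : Matrix n} → (∀ i j → (M ⊗ A) i j ≡ I i j) → ∀ v i → (M · (A · v)) i ≡ v i
·-inverseˡ {M = M} {A} MA≡I v i = begin
  (M · (A · v)) i ≡⟨ ⊗-· M A v i ⟨
  ((M ⊗ A) · v) i ≡⟨ sum-cong-≗ (λ k → cong (_* v k) (MA≡I i k)) ⟩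
  (I · v) i       ≡⟨ ∑-δˡ i v ⟩
  v i             ∎
  where open ≡-Reasoning

column-of-leftInverse : ∀ {n} {M A : Matrix n} → (∀ i j → (M ⊗ A) i j ≡ I i j) →
  ∀ j (y : Vector ℤ n) → (∀ m → (A · y) m ≡ I m j) → ∀ i → M i j ≡ y i
column-of-leftInverse {M = M} {A} MA≡I j y Ay≡eⱼ i = begin
  M i j                        ≡⟨ ∑-δʳ j (M i) ⟨
  (M · (λ m → I m j)) i        ≡⟨ sum-cong-≗ (λ m → cong (M i m *_) (Ay≡eⱼ m)) ⟨
  (M · (A · y)) i              ≡⟨ ·-inverseˡ {M = M} {A} MA≡I y i ⟩
  y i                          ∎
  where open ≡-Reasoning

LowerUnitriangular : ∀ {n} → Matrix n → Set
LowerUnitriangular A = (∀ i → A i i ≡ + 1) × (∀ i j → toℕ i < toℕ j → A i j ≡ + 0)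

record Inverse {n} (A : Matrix n) : Set where
  field
    inv      : Matrix n
    inverseˡ : ∀ i j → (inv ⊗ A) i j ≡ I i j
    inverseʳ : ∀ i j → (A ⊗ inv) i j ≡ I i j

lowerUnitriangular⇒inverse : ∀ {n} {A : Matrix n} → LowerUnitriangular A → Inverse A
lowerUnitriangular⇒inverse {zero}      _                 = record { inv = λ (); inverseˡ = λ (); inverseʳ = λ () }
lowerUnitriangular⇒inverse {suc n} {A} (diag≡1 , upper≡0) = record { inv = M ; inverseˡ = MA≡I ; inverseʳ = AM≡I }
  where
  A′ : Matrix n
  A′ i j = A (suc i) (suc j)

  c : Vector ℤ n
  c i = A (suc i) zero

  A′-lowerUnitriangular : LowerUnitriangular A′
  A′-lowerUnitriangular = (λ i → diag≡1 (suc i)) , λ i j i<j → upper≡0 (suc i) (suc j) (s≤s i<j)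

  open Inverse (lowerUnitriangular⇒inverse A′-lowerUnitriangular)
    renaming (inv to M′; inverseˡ to M′A′≡I; inverseʳ to A′M′≡I)

  -- Block inversion: A = (1 0; c A′) has inverse (1 0; -M′c M′).
  M : Matrix (suc n)
  M zero    zero    = + 1
  M zero    (suc j) = + 0
  M (suc i) zero    = (M′ · (λ k → - c k)) i
  M (suc i) (suc j) = M′ i j

  a₀₀≡1 : A zero zero ≡ + 1
  a₀₀≡1 = diag≡1 zero

  a₀ⱼ≡0 : ∀ j → A zero (suc j) ≡ + 0
  a₀ⱼ≡0 j = upper≡0 zero (suc j) (s≤s z≤n)

  row₀-vanishes : (v : Vector ℤ n) → Σℤ (λ k → A zero (suc k) * v k) ≡ + 0
  row₀-vanishes v = ∑-zero (λ k → cong (_* v k) (a₀ⱼ≡0 k))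

  MA≡I : ∀ i j → (M ⊗ A) i j ≡ I i j
  MA≡I zero    zero    = cong₂ _+_ (trans (*-identityˡ _) a₀₀≡1) (sum-replicate-zero n)
  MA≡I zero    (suc j) = cong₂ _+_ (trans (*-identityˡ _) (a₀ⱼ≡0 j)) (sum-replicate-zero n)
  MA≡I (suc i) zero    =
    trans (cong (_+ (M′ · c) i) (trans (cong (M (suc i) zero *_) a₀₀≡1)
                                       (trans (*-identityʳ _) (·-neg M′ c i))))
          (+-inverseˡ ((M′ · c) i))
  MA≡I (suc i) (suc j) =
    trans (cong₂ _+_ (trans (cong (M (suc i) zero *_) (a₀ⱼ≡0 j)) (*-zeroʳ (M (suc i) zero))) (M′A′≡I i j))
          (trans (+-identityˡ _) (sym (I-suc i j)))

  AM≡I : ∀ i j → (A ⊗ M) i j ≡ I i j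
  AM≡I zero    zero    = cong₂ _+_ (trans (*-identityʳ _) a₀₀≡1) (row₀-vanishes (λ k → M (suc k) zero))
  AM≡I zero    (suc j) = cong₂ _+_ (*-zeroʳ (A zero zero)) (row₀-vanishes (λ k → M′ k j))
  AM≡I (suc i) zero    =
    trans (cong₂ _+_ (*-identityʳ (c i)) (·-inverseˡ {M = A′} {M′} A′M′≡I (λ k → - c k) i)) (+-inverseʳ (c i))
  AM≡I (suc i) (suc j) =
    trans (cong₂ _+_ (*-zeroʳ (c i)) (A′M′≡I i j)) (trans (+-identityˡ _) (sym (I-suc i j)))

-1^_ : ℕ → ℤ
-1^ zero  = + 1
-1^ suc k = - (-1^ k)

sumUpTo : ℕ → (ℕ → ℤ) → ℤ
sumUpTo N g = Σℤ {N} (λ k → g (toℕ k))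

sumUpTo-cong : ∀ N {f g : ℕ → ℤ} → (∀ k → f k ≡ g k) → sumUpTo N f ≡ sumUpTo N g
sumUpTo-cong N f≗g = sum-cong-≗ {N} (λ k → f≗g (toℕ k))

sumUpTo-neg : ∀ N (g : ℕ → ℤ) → sumUpTo N (λ k → - g k) ≡ - sumUpTo N g
sumUpTo-neg N g = ∑-neg {N} (λ k → g (toℕ k))

sumUpTo-*ˡ : ∀ N x (g : ℕ → ℤ) → sumUpTo N (λ k → x * g k) ≡ x * sumUpTo N g
sumUpTo-*ˡ N x g = sym (*-distribˡ-sum {N} x (λ k → g (toℕ k)))

sumUpTo-truncate : ∀ {K N} (g : ℕ → ℤ) → K ≤ N → (∀ k → K ≤ k → g k ≡ + 0) → sumUpTo N g ≡ sumUpTo K g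
sumUpTo-truncate {zero}  {N}     g _         vanish = trans (sumUpTo-cong N (λ k → vanish k z≤n)) (sum-replicate-zero N)
sumUpTo-truncate {suc K} {suc N} g (s≤s K≤N) vanish =
  cong (_+_ (g 0)) (sumUpTo-truncate (λ k → g (suc k)) K≤N (λ k K≤k → vanish (suc k) (s≤s K≤k)))

∑-alternating-C : ∀ N a K →
  sumUpTo K (λ k → -1^ k * + (suc N C suc (a ℕ.+ k))) ≡ + (N C a) - -1^ K * + (N C (a ℕ.+ K))
∑-alternating-C N a zero rewrite ℕ.+-identityʳ a = sym (x-1*x≡0 (+ (N C a)))
  where
  x-1*x≡0 : ∀ x → x - + 1 * x ≡ + 0
  x-1*x≡0 = solve-∀
∑-alternating-C N a (suc K) = begin
  + 1 * + (suc N C suc (a ℕ.+ 0)) + sumUpTo K (λ k → - -1^ k * + (suc N C suc (a ℕ.+ suc k)))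
    ≡⟨ cong₂ _+_ (cong (λ t → + 1 * + (suc N C suc t)) (ℕ.+-identityʳ a)) (sumUpTo-cong K shift) ⟩
  + 1 * + (suc N C suc a) + sumUpTo K (λ k → - (-1^ k * + (suc N C suc (suc a ℕ.+ k))))
    ≡⟨ cong₂ _+_ (cong (λ t → + 1 * + t) (sym (nCk+nC[k+1]≡[n+1]C[k+1] N a)))
                 (sumUpTo-neg K (λ k → -1^ k * + (suc N C suc (suc a ℕ.+ k)))) ⟩
  + 1 * + (N C a ℕ.+ N C suc a) - sumUpTo K (λ k → -1^ k * + (suc N C suc (suc a ℕ.+ k)))
    ≡⟨ cong₂ _-_ (cong (+ 1 *_) (pos-+ (N C a) (N C suc a))) (∑-alternating-C N (suc a) K) ⟩
  + 1 * (+ (N C a) + + (N C suc a)) - (+ (N C suc a) - -1^ K * + (N C (suc a ℕ.+ K)))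
    ≡⟨ cong (λ t → + 1 * (+ (N C a) + + (N C suc a)) - (+ (N C suc a) - -1^ K * + (N C t))) (sym (ℕ.+-suc a K)) ⟩
  + 1 * (+ (N C a) + + (N C suc a)) - (+ (N C suc a) - -1^ K * + (N C (a ℕ.+ suc K)))
    ≡⟨ cancel (+ (N C a)) (+ (N C suc a)) (-1^ K) (+ (N C (a ℕ.+ suc K))) ⟩
  + (N C a) - -1^ suc K * + (N C (a ℕ.+ suc K)) ∎
  where
  open ≡-Reasoning
  shift : ∀ k → - -1^ k * + (suc N C suc (a ℕ.+ suc k)) ≡ - (-1^ k * + (suc N C suc (suc a ℕ.+ k)))
  shift k = trans (cong (λ t → - -1^ k * + (suc N C suc t)) (ℕ.+-suc a k)) (sym (neg-distribˡ-* (-1^ k) _))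
  cancel : ∀ x y s z → + 1 * (x + y) - (y - s * z) ≡ x - (- s) * z
  cancel = solve-∀

firstColumn : ℕ → ℤ
firstColumn zero    = + 1
firstColumn (suc k) = + 2 * -1^ suc k

∑-C*firstColumn : ∀ N a K →
  sumUpTo (suc K) (λ k → + (suc N C (a ℕ.+ k)) * firstColumn k) ≡
  + (suc N C a) - + 2 * (+ (N C a) - -1^ K * + (N C (a ℕ.+ K)))
∑-C*firstColumn N a K = begin
  + (suc N C (a ℕ.+ 0)) * + 1 + sumUpTo K (λ k → + (suc N C (a ℕ.+ suc k)) * (+ 2 * - -1^ k))
    ≡⟨ cong₂ _+_ (trans (*-identityʳ _) (cong (λ t → + (suc N C t)) (ℕ.+-identityʳ a))) (sumUpTo-cong K shift) ⟩
  + (suc N C a) + sumUpTo K (λ k → - + 2 * (-1^ k * + (suc N C suc (a ℕ.+ k))))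
    ≡⟨ cong (_+_ (+ (suc N C a))) (sumUpTo-*ˡ K (- + 2) (λ k → -1^ k * + (suc N C suc (a ℕ.+ k)))) ⟩
  + (suc N C a) + - + 2 * sumUpTo K (λ k → -1^ k * + (suc N C suc (a ℕ.+ k)))
    ≡⟨ cong (λ t → + (suc N C a) + - + 2 * t) (∑-alternating-C N a K) ⟩
  + (suc N C a) + - + 2 * (+ (N C a) - -1^ K * + (N C (a ℕ.+ K)))
    ≡⟨ cong (_+_ (+ (suc N C a))) (sym (neg-distribˡ-* (+ 2) (+ (N C a) - -1^ K * + (N C (a ℕ.+ K))))) ⟩
  + (suc N C a) - + 2 * (+ (N C a) - -1^ K * + (N C (a ℕ.+ K))) ∎
  where
  open ≡-Reasoning
  shift : ∀ k → + (suc N C (a ℕ.+ suc k)) * (+ 2 * - -1^ k) ≡ - + 2 * (-1^ k * + (suc N C suc (a ℕ.+ k)))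
  shift k = trans (cong (λ t → + (suc N C t) * (+ 2 * - -1^ k)) (ℕ.+-suc a k)) (reorder _ (-1^ k))
    where
    reorder : ∀ x s → x * (+ 2 * - s) ≡ - + 2 * (s * x)
    reorder = solve-∀

m<k⇒[2m]C[m+k]≡0 : ∀ {m k} → m < k → (2 ℕ.* m) C (m ℕ.+ k) ≡ 0
m<k⇒[2m]C[m+k]≡0 {m} {k} m<k = k>n⇒nCk≡0 2m<m+k
  where
  2m<m+k : 2 ℕ.* m < m ℕ.+ k
  2m<m+k rewrite ℕ.+-identityʳ m = ℕ.+-monoʳ-< m m<k

L-lowerUnitriangular : ∀ n → LowerUnitriangular (L n)
L-lowerUnitriangular n = diag≡1 , λ i j i<j → cong +_ (m<k⇒[2m]C[m+k]≡0 i<j)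
  where
  diag≡1 : ∀ i → L n i i ≡ + 1
  diag≡1 i rewrite ℕ.+-identityʳ (toℕ i) = cong +_ (nCn≡1 (toℕ i ℕ.+ toℕ i))

centralBinomial≡double : ∀ m → let N = m ℕ.+ suc m in suc N C suc m ≡ N C suc m ℕ.+ N C suc m
centralBinomial≡double m = begin
  suc N C suc m             ≡⟨ nCk+nC[k+1]≡[n+1]C[k+1] N m ⟨
  N C m ℕ.+ N C suc m       ≡⟨ cong (ℕ._+ N C suc m) (nCk≡nC[n∸k] (ℕ.m≤m+n m (suc m))) ⟩
  N C (N ∸ m) ℕ.+ N C suc m ≡⟨ cong (λ t → N C t ℕ.+ N C suc m) (ℕ.m+n∸m≡n m (suc m)) ⟩
  N C suc m ℕ.+ N C suc m   ∎
  where
  open ≡-Reasoning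
  N = m ℕ.+ suc m

L·firstColumn≡e₀ : ∀ n (m : Fin (suc n)) → (L (suc n) · (λ k → firstColumn (toℕ k))) m ≡ I m zero
L·firstColumn≡e₀ n zero    = cong (_+_ (+ 1)) (sum-replicate-zero n)
L·firstColumn≡e₀ n (suc i) = begin
  sumUpTo (suc n) row
    ≡⟨ sumUpTo-truncate row (s≤s (toℕ<n i)) (λ k m<k → cong (λ t → + t * firstColumn k) (m<k⇒[2m]C[m+k]≡0 m<k)) ⟩
  sumUpTo (suc m) row
    ≡⟨ sumUpTo-cong (suc m) (λ k → cong (λ t → + (t C (m ℕ.+ k)) * firstColumn k) 2m≡1+N) ⟩
  sumUpTo (suc m) (λ k → + (suc N C (m ℕ.+ k)) * firstColumn k)
    ≡⟨ ∑-C*firstColumn N m m ⟩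
  + (suc N C m) - + 2 * (+ (N C m) - -1^ m * + (N C (m ℕ.+ m)))
    ≡⟨ cong₂ (λ s t → + s - + 2 * (+ (N C m) - -1^ m * + t)) (centralBinomial≡double m′) (k>n⇒nCk≡0 (ℕ.n<1+n N)) ⟩
  + (N C m ℕ.+ N C m) - + 2 * (+ (N C m) - -1^ m * + 0)
    ≡⟨ cong (λ t → t - + 2 * (+ (N C m) - -1^ m * + 0)) (pos-+ (N C m) (N C m)) ⟩
  + (N C m) + + (N C m) - + 2 * (+ (N C m) - -1^ m * + 0)
    ≡⟨ cancel (+ (N C m)) (-1^ m) ⟩
  + 0 ∎
  where
  open ≡-Reasoning
  m′ = toℕ i
  m  = suc m′
  N  = m′ ℕ.+ m
  row : ℕ → ℤ
  row k = + ((2 ℕ.* m) C (m ℕ.+ k)) * firstColumn k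
  2m≡1+N : 2 ℕ.* m ≡ suc N
  2m≡1+N = cong (λ t → suc (m′ ℕ.+ suc t)) (ℕ.+-identityʳ m′)
  cancel : ∀ x s → x + x - + 2 * (x - s * + 0) ≡ + 0
  cancel = solve-∀

mainTheorem2 : (n : ℕ) →
    Σ (Matrix (suc n)) λ M →
    (∀ i j → (M ⊗ L (suc n)) i j ≡ I i j) ×
    (∀ i j → (L (suc n) ⊗ M) i j ≡ I i j) ×
    (M zero zero ≡ + 1) × ((i : Fin n) → (+ 2) ∣ M (suc i) zero)
mainTheorem2 n = inv , inverseˡ , inverseʳ , column zero , even
  where
  open Inverse (lowerUnitriangular⇒inverse (L-lowerUnitriangular (suc n)))
  column : ∀ i → inv i zero ≡ firstColumn (toℕ i)
  column = column-of-leftInverse {M = inv} {L (suc n)} inverseˡ zero (λ k → firstColumn (toℕ k))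
                                 (L·firstColumn≡e₀ n)
  even : (i : Fin n) → + 2 ∣ inv (suc i) zero
  even i = subst (+ 2 ∣_) (sym (column (suc i))) (*-monoʳ-∣ (+ 2) {+ 1} { -1^ suc (toℕ i)} (1∣ _))
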